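{- For $n\ge1$ let $d_{n,2}(q):=\sum_{w\in\mathcal F_{n,2}}q^{\deg_2(G(w))}$. Then for all $n\ge3$, $$d_{n,2}(q)=d_{n-1,2}(q)+q^2d_{n-2,2}(q),$$ with $d_{1,2}(q)=2q^4$ and $d_{2,2}(q)=q^4+2q^5$. Moreover, for all $n\ge1$, $$d_{n,2}(q)=\sum_{i=1}^{n}\left(\binom{n-1-\lfloor i/2\rfloor}{\lfloor (i-1)/2\rfloor}+\binom{n-2-\lfloor (i-1)/2\rfloor}{\lfloor (i-2)/2\rfloor}\right)q^{i+3}.$$
   Context: $\mathcal F_{n,2}$ is the set of binary words $w=w_1\cdots w_n$ with no two consecutive $1$'s. $P(w)$ is the bargraph polyomino formed by the unit squares $[i-1,i]\times[j-1,j]$, $1\le i\le n$, $1\le j\le w_i+1$. $G(w)$ is the graph whose vertices are the corners of the cells of $P(w)$ and whose edges are the cell sides. $\deg_2(G)$ is the number of vertices of degree $2$ in $G$. Binomial coefficients with integer arguments follow the convention $\binom{a}{a}=1$ for every integer $a$ (in particular $\binom{ -1}{ -1}=1$), $\binom{a}{b}=0$ if $b>a$, and $\binom{a}{b}=0$ if $b<0$ and $b\ne a$. -}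

module Defs where

open import Data.Bool using (Bool; true; false; _∧_; _∨_; not; if_then_else_)
open import Data.Nat using (ℕ; zero; suc; _+_; _*_; _^_; _≤ᵇ_; _≡ᵇ_; _/_)
open import Data.Nat.Combinatorics using (_C_)
open import Data.Integer using (ℤ; +_; -[1+_]; _-_)
open import Data.Nat.ListAction using (sum)
open import Data.List using (List; []; _∷_; map; upTo; filterᵇ; length; concatMap)

-- Binary words (letters false = 0, true = 1) of length n: all 2^n of them.
words : ℕ → List (List Bool)
words zero = [] ∷ []
words (suc n) = concatMap (λ w → (false ∷ w) ∷ (true ∷ w) ∷ []) (words n)

noTwoOnes : List Bool → Bool
noTwoOnes [] = true
noTwoOnes (true ∷ true ∷ w) = false
noTwoOnes (b ∷ w) = noTwoOnes w

F2 : ℕ → List (List Bool)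
F2 n = filterᵇ noTwoOnes (words n)

-- height of column i (1-based) of P(w): w_i + 1; 0 outside 1..n
height : List Bool → ℕ → ℕ
height w zero = 0
height [] (suc i) = 0
height (b ∷ w) (suc zero) = if b then 2 else 1
height (b ∷ w) (suc (suc i)) = height w (suc i)

-- cell (i , j) is the unit square [i-1,i] × [j-1,j]; it belongs to P(w)
-- iff 1 ≤ i ≤ n and 1 ≤ j ≤ w_i + 1
cell : List Bool → ℕ → ℕ → Bool
cell w i j = (1 ≤ᵇ j) ∧ (j ≤ᵇ height w i)

-- G(w): vertices are corners of cells, edges are unit cell sides.
-- (x , y) is a corner of some cell
isVertex : List Bool → ℕ → ℕ → Bool
isVertex w x y = cell w x y ∨ cell w (suc x) y ∨ cell w x (suc y) ∨ cell w (suc x) (suc y)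

-- edges at (x , y): each unit segment is an edge iff it is a side of a cell
rightE leftE upE downE : List Bool → ℕ → ℕ → Bool
rightE w x y = cell w (suc x) y ∨ cell w (suc x) (suc y)
leftE w zero y = false
leftE w (suc x) y = cell w (suc x) y ∨ cell w (suc x) (suc y)
upE w x y = cell w x (suc y) ∨ cell w (suc x) (suc y)
downE w x zero = false
downE w x (suc y) = cell w x (suc y) ∨ cell w (suc x) (suc y)

b2n : Bool → ℕ
b2n true = 1
b2n false = 0

degree : List Bool → ℕ → ℕ → ℕ
degree w x y = b2n (rightE w x y) + b2n (leftE w x y) + b2n (upE w x y) + b2n (downE w x y)

-- number of degree-2 vertices of G(w). All vertices have 0 ≤ x ≤ n and
-- 0 ≤ y ≤ 2 (heights are at most 2), so scanning x ≤ n, y ≤ 3 covers all.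
deg2 : List Bool → ℕ
deg2 w = sum (map (λ x → sum (map (λ y →
           b2n (isVertex w x y ∧ (degree w x y ≡ᵇ 2))) (upTo 4))) (upTo (suc (length w))))

d : ℕ → ℕ → ℕ
d n q = sum (map (λ w → q ^ deg2 w) (F2 n))

floorHalf : ℤ → ℤ
floorHalf (+ n) = + (n / 2)
floorHalf -[1+ n ] = -[1+ (n / 2) ]

-- integer binomial with the convention: C(a,a)=1 for all a, C(a,b)=0 if b>a,
-- C(a,b)=0 if b<0 and b ≠ a.
binomℤ : ℤ → ℤ → ℕ
binomℤ (+ a) (+ b) = a C b
binomℤ (+ a) -[1+ b ] = 0
binomℤ -[1+ a ] (+ b) = 0
binomℤ -[1+ a ] -[1+ b ] = if a ≡ᵇ b then 1 else 0

coeff : ℕ → ℕ → ℕ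
coeff n i = binomℤ (+ n - + 1 - floorHalf (+ i)) (floorHalf (+ i - + 1))
          + binomℤ (+ n - + 2 - floorHalf (+ i - + 1)) (floorHalf (+ i - + 2))

closedForm : ℕ → ℕ → ℕ
closedForm n q = sum (map (λ k → coeff n (suc k) * q ^ (suc k + 3)) (upTo n))

-- Reading G(w) line by line, the vertical lines x = 0 and x = n each carry two vertices of
-- degree 2, and an interior line carries one exactly when the two adjacent columns have
-- different heights; hence deg₂(G(w)) = 4 + (number of letter changes in w). Splitting words
-- by their first letter, the change-counting sums A_n (first letter 0) and B_n (first letter 1)
-- obey A_{n+1} = A_n + q B_n and B_{n+1} = q A_n, which yields the second-order recurrence.
-- For the closed form, b(n,i) = C(n-1-⌊i/2⌋, ⌊(i-1)/2⌋) satisfies b(n,i) = b(n-1,i) + b(n-2,i-2)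
-- by Pascal's rule and vanishes for i > n; the coefficient of q^(i+3) is b(n,i) + b(n-1,i-1),
-- so the closed form obeys the same recurrence with the same initial values.
module Submission where

open import Defs
open import Data.Bool using (Bool; true; false; _∧_; _xor_; if_then_else_)
open import Data.Nat using (ℕ; zero; suc; _+_; _*_; _^_; _∸_; _/_; _<_; _≤_; _≥_; _≡ᵇ_; s≤s; z≤n)
open import Data.Nat.Properties
  using (+-comm; +-assoc; +-identityʳ; *-identityˡ; *-identityʳ; *-zeroʳ; *-assoc; *-distribˡ-+;
         ^-distribˡ-+-*; ≤-pred; ≤-trans; ≤-refl; ≤-reflexive; +-commutativeSemigroup)
open import Data.Nat.DivMod using (m/n≡1+[m∸n]/n)
open import Data.Nat.Combinatorics using (_C_; nCk+nC[k+1]≡[n+1]C[k+1]; k>n⇒nCk≡0)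
open import Data.Nat.ListAction using (sum)
open import Data.Nat.Tactic.RingSolver using (solve-∀)
open import Algebra.Properties.CommutativeSemigroup +-commutativeSemigroup using (interchange; x∙yz≈y∙xz)
open import Data.Integer using (+_; -[1+_]; _⊖_; -_; pred) renaming (suc to sucℤ; _+_ to _+ℤ_; _-_ to _-ℤ_)
import Data.Integer.Properties as ℤP
open import Data.List using (List; []; _∷_; map; applyUpTo; upTo; filterᵇ; length; concatMap)
open import Data.List.Properties using (map-cong)
open import Data.Product using (_×_; _,_; proj₁)
open import Function using (_∘_; id)
open import Relation.Binary.PropositionalEquality
  using (_≡_; refl; sym; trans; cong; cong₂; module ≡-Reasoning)
open ≡-Reasoning

sumUpTo : (ℕ → ℕ) → ℕ → ℕ
sumUpTo f zero = 0
sumUpTo f (suc n) = f 0 + sumUpTo (f ∘ suc) n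

sum-map-applyUpTo : ∀ (f g : ℕ → ℕ) n → sum (map f (applyUpTo g n)) ≡ sumUpTo (f ∘ g) n
sum-map-applyUpTo f g zero = refl
sum-map-applyUpTo f g (suc n) = cong (_+_ (f (g 0))) (sum-map-applyUpTo f (g ∘ suc) n)

sumUpTo-cong : ∀ {f g : ℕ → ℕ} → (∀ k → f k ≡ g k) → ∀ n → sumUpTo f n ≡ sumUpTo g n
sumUpTo-cong f≗g zero = refl
sumUpTo-cong f≗g (suc n) = cong₂ _+_ (f≗g 0) (sumUpTo-cong (f≗g ∘ suc) n)

sumUpTo-+ : ∀ (f g : ℕ → ℕ) n → sumUpTo (λ k → f k + g k) n ≡ sumUpTo f n + sumUpTo g n
sumUpTo-+ f g zero = refl
sumUpTo-+ f g (suc n) = begin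
  (f 0 + g 0) + sumUpTo (λ k → f (suc k) + g (suc k)) n
    ≡⟨ cong (_+_ (f 0 + g 0)) (sumUpTo-+ (f ∘ suc) (g ∘ suc) n) ⟩
  (f 0 + g 0) + (sumUpTo (f ∘ suc) n + sumUpTo (g ∘ suc) n)
    ≡⟨ interchange (f 0) (g 0) _ _ ⟩
  (f 0 + sumUpTo (f ∘ suc) n) + (g 0 + sumUpTo (g ∘ suc) n) ∎

sumUpTo-*ˡ : ∀ a (f : ℕ → ℕ) n → sumUpTo (λ k → a * f k) n ≡ a * sumUpTo f n
sumUpTo-*ˡ a f zero = sym (*-zeroʳ a)
sumUpTo-*ˡ a f (suc n) =
  trans (cong (_+_ (a * f 0)) (sumUpTo-*ˡ a (f ∘ suc) n)) (sym (*-distribˡ-+ a (f 0) _))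

sumUpTo-snoc : ∀ (f : ℕ → ℕ) n → sumUpTo f (suc n) ≡ sumUpTo f n + f n
sumUpTo-snoc f zero = +-identityʳ (f 0)
sumUpTo-snoc f (suc n) =
  trans (cong (_+_ (f 0)) (sumUpTo-snoc (f ∘ suc) n)) (sym (+-assoc (f 0) _ _))

sumOver : {A : Set} → List A → (A → ℕ) → ℕ
sumOver xs f = sum (map f xs)

sumOver-cong : ∀ {A : Set} (xs : List A) {f g : A → ℕ} → (∀ x → f x ≡ g x) → sumOver xs f ≡ sumOver xs g
sumOver-cong xs f≗g = cong sum (map-cong f≗g xs)

sumOver-*ˡ : ∀ {A : Set} (xs : List A) a (f : A → ℕ) → sumOver xs (λ x → a * f x) ≡ a * sumOver xs f
sumOver-*ˡ [] a f = sym (*-zeroʳ a)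
sumOver-*ˡ (x ∷ xs) a f =
  trans (cong (_+_ (a * f x)) (sumOver-*ˡ xs a f)) (sym (*-distribˡ-+ a (f x) _))

sumOver-filterᵇ-∷ : ∀ {A : Set} (p : A → Bool) x xs (f : A → ℕ) →
  sumOver (filterᵇ p (x ∷ xs)) f ≡ (if p x then f x else 0) + sumOver (filterᵇ p xs) f
sumOver-filterᵇ-∷ p x xs f with p x
... | true = refl
... | false = refl

sumOver-filterᵇ-none : ∀ {A : Set} (xs : List A) (f : A → ℕ) → sumOver (filterᵇ (λ _ → false) xs) f ≡ 0
sumOver-filterᵇ-none [] f = refl
sumOver-filterᵇ-none (x ∷ xs) f = sumOver-filterᵇ-none xs f

second-order-recurrence-unique : ∀ c (f g : ℕ → ℕ) → f 1 ≡ g 1 → f 2 ≡ g 2 →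
  (∀ n → f (3 + n) ≡ f (2 + n) + c * f (1 + n)) →
  (∀ n → g (3 + n) ≡ g (2 + n) + c * g (1 + n)) →
  ∀ n → f (suc n) ≡ g (suc n)
second-order-recurrence-unique c f g f₁≡g₁ f₂≡g₂ f-rec g-rec n = proj₁ (consecutive n)
  where
  consecutive : ∀ n → f (1 + n) ≡ g (1 + n) × f (2 + n) ≡ g (2 + n)
  consecutive zero = f₁≡g₁ , f₂≡g₂
  consecutive (suc n) with consecutive n
  ... | fₙ≡gₙ , fₙ₊₁≡gₙ₊₁ =
    fₙ₊₁≡gₙ₊₁ , trans (f-rec n) (trans (cong₂ (λ x y → x + c * y) fₙ₊₁≡gₙ₊₁ fₙ≡gₙ) (sym (g-rec n)))

square-* : ∀ q x → q ^ 2 * x ≡ q * (q * x)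
square-* q x = trans (cong (λ s → q * s * x) (*-identityʳ q)) (*-assoc q q x)

deg2OnLine : List Bool → ℕ → ℕ
deg2OnLine w x = sum (map (λ y → b2n (isVertex w x y ∧ (degree w x y ≡ᵇ 2))) (upTo 4))

deg2Tail : List Bool → ℕ
deg2Tail w = sumUpTo (deg2OnLine w ∘ suc) (length w)

deg2≡deg2OnLine0+deg2Tail : ∀ w → deg2 w ≡ deg2OnLine w 0 + deg2Tail w
deg2≡deg2OnLine0+deg2Tail w = sum-map-applyUpTo (deg2OnLine w) id (suc (length w))

changes : List Bool → ℕ
changes (b ∷ c ∷ w) = b2n (b xor c) + changes (c ∷ w)
changes _ = 0

deg2OnLine-first : ∀ b w → deg2OnLine (b ∷ w) 0 ≡ 2
deg2OnLine-first false w = refl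
deg2OnLine-first true w = refl

deg2OnLine-last : ∀ b → deg2OnLine (b ∷ []) 1 ≡ 2
deg2OnLine-last false = refl
deg2OnLine-last true = refl

-- Between columns of different heights only the top corner of the taller one has degree 2;
-- between columns of equal height no vertex does.
deg2OnLine-between : ∀ b c w → deg2OnLine (b ∷ c ∷ w) 1 ≡ b2n (b xor c)
deg2OnLine-between false false w = refl
deg2OnLine-between false true w = refl
deg2OnLine-between true false w = refl
deg2OnLine-between true true w = refl

deg2Tail≡2+changes : ∀ b w → deg2Tail (b ∷ w) ≡ 2 + changes (b ∷ w)
deg2Tail≡2+changes b [] = cong (_+ 0) (deg2OnLine-last b)
deg2Tail≡2+changes b (c ∷ w) = begin
  deg2OnLine (b ∷ c ∷ w) 1 + deg2Tail (c ∷ w)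
    ≡⟨ cong₂ _+_ (deg2OnLine-between b c w) (deg2Tail≡2+changes c w) ⟩
  b2n (b xor c) + (2 + changes (c ∷ w))
    ≡⟨ x∙yz≈y∙xz (b2n (b xor c)) 2 (changes (c ∷ w)) ⟩
  2 + changes (b ∷ c ∷ w) ∎

deg2≡4+changes : ∀ b w → deg2 (b ∷ w) ≡ 4 + changes (b ∷ w)
deg2≡4+changes b w =
  trans (deg2≡deg2OnLine0+deg2Tail (b ∷ w)) (cong₂ _+_ (deg2OnLine-first b w) (deg2Tail≡2+changes b w))

extend : List Bool → List (List Bool)
extend w = (false ∷ w) ∷ (true ∷ w) ∷ []

sumOver-filterᵇ-extend : ∀ ws (p : List Bool → Bool) (f : List Bool → ℕ) →
  sumOver (filterᵇ p (concatMap extend ws)) f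
    ≡ sumOver (filterᵇ (p ∘ (false ∷_)) ws) (f ∘ (false ∷_))
    + sumOver (filterᵇ (p ∘ (true ∷_)) ws) (f ∘ (true ∷_))
sumOver-filterᵇ-extend [] p f = refl
sumOver-filterᵇ-extend (w ∷ ws) p f = begin
  sumOver (filterᵇ p ((false ∷ w) ∷ (true ∷ w) ∷ concatMap extend ws)) f
    ≡⟨ sumOver-filterᵇ-∷ p (false ∷ w) _ f ⟩
  a + sumOver (filterᵇ p ((true ∷ w) ∷ concatMap extend ws)) f
    ≡⟨ cong (_+_ a) (sumOver-filterᵇ-∷ p (true ∷ w) _ f) ⟩
  a + (b + sumOver (filterᵇ p (concatMap extend ws)) f)
    ≡⟨ cong (λ s → a + (b + s)) (sumOver-filterᵇ-extend ws p f) ⟩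
  a + (b + (sumOver (filterᵇ (p ∘ (false ∷_)) ws) (f ∘ (false ∷_))
          + sumOver (filterᵇ (p ∘ (true ∷_)) ws) (f ∘ (true ∷_))))
    ≡⟨ shuffle a b _ _ ⟩
  (a + sumOver (filterᵇ (p ∘ (false ∷_)) ws) (f ∘ (false ∷_)))
    + (b + sumOver (filterᵇ (p ∘ (true ∷_)) ws) (f ∘ (true ∷_)))
    ≡⟨ sym (cong₂ _+_ (sumOver-filterᵇ-∷ (p ∘ (false ∷_)) w ws (f ∘ (false ∷_)))
                      (sumOver-filterᵇ-∷ (p ∘ (true ∷_)) w ws (f ∘ (true ∷_)))) ⟩
  sumOver (filterᵇ (p ∘ (false ∷_)) (w ∷ ws)) (f ∘ (false ∷_))
    + sumOver (filterᵇ (p ∘ (true ∷_)) (w ∷ ws)) (f ∘ (true ∷_)) ∎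
  where
  a b : ℕ
  a = if p (false ∷ w) then f (false ∷ w) else 0
  b = if p (true ∷ w) then f (true ∷ w) else 0
  shuffle : ∀ a b c e → a + (b + (c + e)) ≡ (a + c) + (b + e)
  shuffle = solve-∀

follows : Bool → ℕ → List (List Bool)
follows b n = filterᵇ (noTwoOnes ∘ (b ∷_)) (words n)

changeGF : Bool → ℕ → ℕ → ℕ
changeGF b n q = sumOver (follows b n) (λ w → q ^ changes (b ∷ w))

changeGF-false-suc : ∀ n q → changeGF false (suc n) q ≡ changeGF false n q + q * changeGF true n q
changeGF-false-suc n q =
  trans (sumOver-filterᵇ-extend (words n) noTwoOnes (λ w → q ^ changes (false ∷ w)))
        (cong (_+_ (changeGF false n q)) (sumOver-*ˡ (follows true n) q (λ w → q ^ changes (true ∷ w))))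

changeGF-true-suc : ∀ n q → changeGF true (suc n) q ≡ q * changeGF false n q
changeGF-true-suc n q = begin
  changeGF true (suc n) q
    ≡⟨ sumOver-filterᵇ-extend (words n) (noTwoOnes ∘ (true ∷_)) (λ w → q ^ changes (true ∷ w)) ⟩
  sumOver (follows false n) (λ w → q * q ^ changes (false ∷ w))
    + sumOver (filterᵇ (λ _ → false) (words n)) (λ w → q ^ changes (true ∷ true ∷ w))
    ≡⟨ cong₂ _+_ (sumOver-*ˡ (follows false n) q (λ w → q ^ changes (false ∷ w)))
                 (sumOver-filterᵇ-none (words n) _) ⟩
  q * changeGF false n q + 0
    ≡⟨ +-identityʳ _ ⟩
  q * changeGF false n q ∎

changeGFSum : ℕ → ℕ → ℕ
changeGFSum n q = changeGF false n q + changeGF true n q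

changeGFSum-rec : ∀ n q → changeGFSum (2 + n) q ≡ changeGFSum (1 + n) q + q ^ 2 * changeGFSum n q
changeGFSum-rec n q = begin
  changeGF false (2 + n) q + changeGF true (2 + n) q
    ≡⟨ cong₂ _+_ (changeGF-false-suc (1 + n) q) (changeGF-true-suc (1 + n) q) ⟩
  (F₁ + q * changeGF true (1 + n) q) + q * changeGF false (1 + n) q
    ≡⟨ cong₂ (λ t f → (F₁ + q * t) + q * f) (changeGF-true-suc n q) (changeGF-false-suc n q) ⟩
  (F₁ + q * (q * F₀)) + q * (F₀ + q * T₀)
    ≡⟨ regroup q F₁ F₀ T₀ ⟩
  (F₁ + q * F₀) + q * (q * (F₀ + T₀))
    ≡⟨ cong₂ (λ t s → (F₁ + t) + s) (sym (changeGF-true-suc n q)) (sym (square-* q _)) ⟩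
  changeGFSum (1 + n) q + q ^ 2 * changeGFSum n q ∎
  where
  F₁ F₀ T₀ : ℕ
  F₁ = changeGF false (1 + n) q
  F₀ = changeGF false n q
  T₀ = changeGF true n q
  regroup : ∀ q a x y → (a + q * (q * x)) + q * (x + q * y) ≡ (a + q * x) + q * (q * (x + y))
  regroup = solve-∀

d-suc : ∀ n q → d (suc n) q ≡ q ^ 4 * changeGFSum n q
d-suc n q = begin
  d (suc n) q
    ≡⟨ sumOver-filterᵇ-extend (words n) noTwoOnes (λ w → q ^ deg2 w) ⟩
  sumOver (follows false n) (λ w → q ^ deg2 (false ∷ w)) + sumOver (follows true n) (λ w → q ^ deg2 (true ∷ w))
    ≡⟨ cong₂ _+_ (weight false) (weight true) ⟩
  q ^ 4 * changeGF false n q + q ^ 4 * changeGF true n q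
    ≡⟨ sym (*-distribˡ-+ (q ^ 4) _ _) ⟩
  q ^ 4 * changeGFSum n q ∎
  where
  weight : ∀ b → sumOver (follows b n) (λ w → q ^ deg2 (b ∷ w)) ≡ q ^ 4 * changeGF b n q
  weight b = trans (sumOver-cong (follows b n) (λ w →
                      trans (cong (q ^_) (deg2≡4+changes b w)) (^-distribˡ-+-* q 4 (changes (b ∷ w)))))
                   (sumOver-*ˡ (follows b n) (q ^ 4) (λ w → q ^ changes (b ∷ w)))

d-rec : ∀ n q → d (3 + n) q ≡ d (2 + n) q + q ^ 2 * d (1 + n) q
d-rec n q = begin
  d (3 + n) q
    ≡⟨ d-suc (2 + n) q ⟩
  q ^ 4 * changeGFSum (2 + n) q
    ≡⟨ cong (q ^ 4 *_) (changeGFSum-rec n q) ⟩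
  q ^ 4 * (changeGFSum (1 + n) q + q ^ 2 * changeGFSum n q)
    ≡⟨ distrib (q ^ 4) (q ^ 2) _ _ ⟩
  q ^ 4 * changeGFSum (1 + n) q + q ^ 2 * (q ^ 4 * changeGFSum n q)
    ≡⟨ sym (cong₂ (λ x y → x + q ^ 2 * y) (d-suc (1 + n) q) (d-suc n q)) ⟩
  d (2 + n) q + q ^ 2 * d (1 + n) q ∎
  where
  distrib : ∀ a b x y → a * (x + b * y) ≡ a * x + b * (a * y)
  distrib = solve-∀

half-suc-suc : ∀ k → suc (suc k) / 2 ≡ suc (k / 2)
half-suc-suc k = m/n≡1+[m∸n]/n {suc (suc k)} {2} (s≤s (s≤s z≤n))

half-suc+half≡id : ∀ k → suc k / 2 + k / 2 ≡ k
half-suc+half≡id zero = refl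
half-suc+half≡id (suc k) = begin
  suc (suc k) / 2 + suc k / 2   ≡⟨ cong (_+ suc k / 2) (half-suc-suc k) ⟩
  suc (k / 2 + suc k / 2)       ≡⟨ cong suc (+-comm (k / 2) _) ⟩
  suc (suc k / 2 + k / 2)       ≡⟨ cong suc (half-suc+half≡id k) ⟩
  suc k                         ∎

floorHalf-⊖1 : ∀ k → floorHalf (k ⊖ 1) ≡ pred (+ (suc k / 2))
floorHalf-⊖1 zero = refl
floorHalf-⊖1 (suc k) = sym (cong (pred ∘ +_) (half-suc-suc k))

+m-+a-+b≡m⊖[a+b] : ∀ m a b → + m -ℤ + a -ℤ + b ≡ m ⊖ (a + b)
+m-+a-+b≡m⊖[a+b] m a b = begin
  + m -ℤ + a -ℤ + b      ≡⟨ ℤP.+-assoc (+ m) (- + a) (- + b) ⟩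
  + m +ℤ (- + a -ℤ + b)  ≡⟨ cong (+ m +ℤ_) (sym (ℤP.neg-distrib-+ (+ a) (+ b))) ⟩
  + m -ℤ (+ a +ℤ + b)    ≡⟨ cong (λ x → + m -ℤ x) (sym (ℤP.pos-+ a b)) ⟩
  + m -ℤ + (a + b)       ≡⟨ ℤP.m-n≡m⊖n m (a + b) ⟩
  m ⊖ (a + b)            ∎

binomℤ-pascal : ∀ a j → binomℤ (sucℤ a) (+ j) ≡ binomℤ a (+ j) + binomℤ a (pred (+ j))
binomℤ-pascal (+ m) zero = refl
binomℤ-pascal (+ m) (suc j) = sym (trans (+-comm (m C suc j) (m C j)) (nCk+nC[k+1]≡[n+1]C[k+1] m j))
binomℤ-pascal -[1+ zero ] zero = refl
binomℤ-pascal -[1+ zero ] (suc j) = refl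
binomℤ-pascal -[1+ suc m ] zero = refl
binomℤ-pascal -[1+ suc m ] (suc j) = refl

binomℤ-⊖-vanishes : ∀ n a b → n < a + b → binomℤ (n ⊖ a) (+ b) ≡ 0
binomℤ-⊖-vanishes n zero b n<b = k>n⇒nCk≡0 n<b
binomℤ-⊖-vanishes zero (suc a) b _ = refl
binomℤ-⊖-vanishes (suc n) (suc a) b n<a+b =
  trans (cong (λ t → binomℤ t (+ b)) (ℤP.[1+m]⊖[1+n]≡m⊖n n a)) (binomℤ-⊖-vanishes n a b (≤-pred n<a+b))

coeffSummand : ℕ → ℕ → ℕ
coeffSummand n i = binomℤ (n ⊖ suc (i / 2)) (floorHalf (i ⊖ 1))

coeff≡coeffSummand+coeffSummand : ∀ n i → coeff (suc n) (suc i) ≡ coeffSummand (suc n) (suc i) + coeffSummand n i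
coeff≡coeffSummand+coeffSummand n i = cong₂ _+_
  (cong (λ t → binomℤ t (+ (i / 2))) (+m-+a-+b≡m⊖[a+b] (suc n) 1 (suc i / 2)))
  (cong₂ binomℤ
    (trans (+m-+a-+b≡m⊖[a+b] (suc n) 2 (i / 2)) (ℤP.[1+m]⊖[1+n]≡m⊖n n (suc (i / 2))))
    (cong floorHalf (ℤP.[1+m]⊖[1+n]≡m⊖n i 1)))

coeffSummand-pascal : ∀ m k → coeffSummand (2 + m) (2 + k) ≡ coeffSummand (1 + m) (2 + k) + coeffSummand m k
coeffSummand-pascal m k = begin
  binomℤ (suc (suc m) ⊖ suc (suc (suc k) / 2)) (+ j)
    ≡⟨ cong (λ t → binomℤ t (+ j)) (trans (top-shift (suc m)) (sym (ℤP.distribʳ-⊖-+-pos 1 m (suc h)))) ⟩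
  binomℤ (sucℤ (m ⊖ suc h)) (+ j)
    ≡⟨ binomℤ-pascal (m ⊖ suc h) j ⟩
  binomℤ (m ⊖ suc h) (+ j) + binomℤ (m ⊖ suc h) (pred (+ j))
    ≡⟨ sym (cong₂ _+_ (cong (λ t → binomℤ t (+ j)) (top-shift m))
                      (cong (binomℤ (m ⊖ suc h)) (floorHalf-⊖1 k))) ⟩
  coeffSummand (1 + m) (2 + k) + coeffSummand m k ∎
  where
  h j : ℕ
  h = k / 2
  j = suc k / 2
  top-shift : ∀ m → suc m ⊖ suc (suc (suc k) / 2) ≡ m ⊖ suc h
  top-shift m = trans (cong (λ x → suc m ⊖ suc x) (half-suc-suc k)) (ℤP.[1+m]⊖[1+n]≡m⊖n m (suc h))

coeffSummand-vanishes : ∀ {n k} → n ≤ k → coeffSummand n (suc k) ≡ 0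
coeffSummand-vanishes {n} {k} n≤k =
  binomℤ-⊖-vanishes n (suc (suc k / 2)) (k / 2) (s≤s (≤-trans n≤k (≤-reflexive (sym (half-suc+half≡id k)))))

coeff-rec : ∀ m k → coeff (3 + m) (3 + k) ≡ coeff (2 + m) (3 + k) + coeff (1 + m) (1 + k)
coeff-rec m k = begin
  coeff (3 + m) (3 + k)
    ≡⟨ coeff≡coeffSummand+coeffSummand (2 + m) (2 + k) ⟩
  coeffSummand (3 + m) (3 + k) + coeffSummand (2 + m) (2 + k)
    ≡⟨ cong₂ _+_ (coeffSummand-pascal (1 + m) (1 + k)) (coeffSummand-pascal m k) ⟩
  (coeffSummand (2 + m) (3 + k) + coeffSummand (1 + m) (1 + k))
    + (coeffSummand (1 + m) (2 + k) + coeffSummand m k)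
    ≡⟨ interchange (coeffSummand (2 + m) (3 + k)) (coeffSummand (1 + m) (1 + k))
                   (coeffSummand (1 + m) (2 + k)) (coeffSummand m k) ⟩
  (coeffSummand (2 + m) (3 + k) + coeffSummand (1 + m) (2 + k))
    + (coeffSummand (1 + m) (1 + k) + coeffSummand m k)
    ≡⟨ sym (cong₂ _+_ (coeff≡coeffSummand+coeffSummand (1 + m) (2 + k)) (coeff≡coeffSummand+coeffSummand m k)) ⟩
  coeff (2 + m) (3 + k) + coeff (1 + m) (1 + k) ∎

coeff-vanishes-above : ∀ m → coeff (2 + m) (3 + m) ≡ 0
coeff-vanishes-above m = trans (coeff≡coeffSummand+coeffSummand (1 + m) (2 + m))
  (cong₂ _+_ (coeffSummand-vanishes (≤-refl {2 + m})) (coeffSummand-vanishes (≤-refl {1 + m})))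

closedFormTerm : ℕ → ℕ → ℕ → ℕ
closedFormTerm n q k = coeff n (suc k) * q ^ (suc k + 3)

closedForm≡sumUpTo : ∀ n q → closedForm n q ≡ sumUpTo (closedFormTerm n q) n
closedForm≡sumUpTo n q = sum-map-applyUpTo (closedFormTerm n q) id n

closedFormTerm-rec : ∀ m q k →
  closedFormTerm (3 + m) q (2 + k) ≡ closedFormTerm (2 + m) q (2 + k) + q ^ 2 * closedFormTerm (1 + m) q k
closedFormTerm-rec m q k = begin
  coeff (3 + m) (3 + k) * q ^ (3 + k + 3)
    ≡⟨ cong (_* q ^ (3 + k + 3)) (coeff-rec m k) ⟩
  (coeff (2 + m) (3 + k) + coeff (1 + m) (1 + k)) * (q * (q * q ^ (1 + k + 3)))
    ≡⟨ distrib (coeff (2 + m) (3 + k)) (coeff (1 + m) (1 + k)) q (q ^ (1 + k + 3)) ⟩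
  coeff (2 + m) (3 + k) * q ^ (3 + k + 3) + q * (q * closedFormTerm (1 + m) q k)
    ≡⟨ cong (_+_ (closedFormTerm (2 + m) q (2 + k))) (sym (square-* q _)) ⟩
  closedFormTerm (2 + m) q (2 + k) + q ^ 2 * closedFormTerm (1 + m) q k ∎
  where
  distrib : ∀ a b q x → (a + b) * (q * (q * x)) ≡ a * (q * (q * x)) + q * (q * (b * x))
  distrib = solve-∀

closedForm-rec : ∀ m q → closedForm (3 + m) q ≡ closedForm (2 + m) q + q ^ 2 * closedForm (1 + m) q
closedForm-rec m q = begin
  closedForm (3 + m) q
    ≡⟨ closedForm≡sumUpTo (3 + m) q ⟩
  -- coeff (3 + m) i and coeff (2 + m) i agree by computation for i = 1, 2
  T₂ 0 + (T₂ 1 + sumUpTo (λ k → T₃ (2 + k)) (1 + m))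
    ≡⟨ cong (λ s → T₂ 0 + (T₂ 1 + s)) tail ⟩
  T₂ 0 + (T₂ 1 + (sumUpTo (λ k → T₂ (2 + k)) m + q ^ 2 * sumUpTo T₁ (1 + m)))
    ≡⟨ cong (_+_ (T₂ 0)) (sym (+-assoc (T₂ 1) _ _)) ⟩
  T₂ 0 + ((T₂ 1 + sumUpTo (λ k → T₂ (2 + k)) m) + q ^ 2 * sumUpTo T₁ (1 + m))
    ≡⟨ sym (+-assoc (T₂ 0) _ _) ⟩
  sumUpTo T₂ (2 + m) + q ^ 2 * sumUpTo T₁ (1 + m)
    ≡⟨ sym (cong₂ (λ x y → x + q ^ 2 * y) (closedForm≡sumUpTo (2 + m) q) (closedForm≡sumUpTo (1 + m) q)) ⟩
  closedForm (2 + m) q + q ^ 2 * closedForm (1 + m) q ∎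
  where
  T₁ T₂ T₃ : ℕ → ℕ
  T₁ = closedFormTerm (1 + m) q
  T₂ = closedFormTerm (2 + m) q
  T₃ = closedFormTerm (3 + m) q
  tail : sumUpTo (λ k → T₃ (2 + k)) (1 + m) ≡ sumUpTo (λ k → T₂ (2 + k)) m + q ^ 2 * sumUpTo T₁ (1 + m)
  tail = begin
    sumUpTo (λ k → T₃ (2 + k)) (1 + m)
      ≡⟨ sumUpTo-cong (closedFormTerm-rec m q) (1 + m) ⟩
    sumUpTo (λ k → T₂ (2 + k) + q ^ 2 * T₁ k) (1 + m)
      ≡⟨ sumUpTo-+ (λ k → T₂ (2 + k)) (λ k → q ^ 2 * T₁ k) (1 + m) ⟩
    sumUpTo (λ k → T₂ (2 + k)) (1 + m) + sumUpTo (λ k → q ^ 2 * T₁ k) (1 + m)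
      ≡⟨ cong₂ _+_ (sumUpTo-snoc (λ k → T₂ (2 + k)) m) (sumUpTo-*ˡ (q ^ 2) T₁ (1 + m)) ⟩
    (sumUpTo (λ k → T₂ (2 + k)) m + T₂ (2 + m)) + q ^ 2 * sumUpTo T₁ (1 + m)
      ≡⟨ cong (λ t → (sumUpTo (λ k → T₂ (2 + k)) m + t * q ^ (3 + m + 3)) + q ^ 2 * sumUpTo T₁ (1 + m))
              (coeff-vanishes-above m) ⟩
    (sumUpTo (λ k → T₂ (2 + k)) m + 0) + q ^ 2 * sumUpTo T₁ (1 + m)
      ≡⟨ cong (_+ q ^ 2 * sumUpTo T₁ (1 + m)) (+-identityʳ _) ⟩
    sumUpTo (λ k → T₂ (2 + k)) m + q ^ 2 * sumUpTo T₁ (1 + m) ∎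

theorem3p5 : ((n : ℕ) → n ≥ 3 → (q : ℕ) → d n q ≡ d (n ∸ 1) q + q ^ 2 * d (n ∸ 2) q)
           × ((q : ℕ) → d 1 q ≡ 2 * q ^ 4)
           × ((q : ℕ) → d 2 q ≡ q ^ 4 + 2 * q ^ 5)
           × ((n : ℕ) → n ≥ 1 → (q : ℕ) → d n q ≡ closedForm n q)
theorem3p5 = recurrence , (λ q → refl) , (λ q → refl) , closed
  where
  recurrence : (n : ℕ) → n ≥ 3 → (q : ℕ) → d n q ≡ d (n ∸ 1) q + q ^ 2 * d (n ∸ 2) q
  recurrence (suc (suc (suc n))) (s≤s (s≤s (s≤s _))) q = d-rec n q
  closed : (n : ℕ) → n ≥ 1 → (q : ℕ) → d n q ≡ closedForm n q
  closed (suc n) _ q = second-order-recurrence-unique (q ^ 2) (λ k → d k q) (λ k → closedForm k q)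
    (sym (+-identityʳ _))
    (sym (cong₂ _+_ (*-identityˡ (q ^ 4)) (+-identityʳ _)))
    (λ k → d-rec k q) (λ k → closedForm-rec k q) n
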